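{- Let $\mathcal{M}=(V,\mathcal{I})$ be a matroid of rank $k$ without loops, let $V'\subseteq V$, $\mathcal{M}'=\mathcal{M}|V'$, and let $U_1,\dots,U_k$ be the density-based decomposition of $V'$. Then for all $1\le j\le k-1$, $$\rho_{\mathcal{M}'/(U_1\cup\dots\cup U_{j-1})}(U_j)\ge\rho_{\mathcal{M}'/(U_1\cup\dots\cup U_j)}(U_{j+1}),$$ and if moreover $\rho_{\mathcal{M}'/(U_1\cup\dots\cup U_{j-1})}(U_j)>0$, the inequality is strict.
   Context: For a matroid $\mathcal{N}$ and a subset $U$ of its ground set, $\rho_{\mathcal{N}}(U)=|U|/\mathrm{rank}_{\mathcal{N}}(U)$, with $\rho_{\mathcal{N}}(\emptyset)=0$ and $+\infty$ for nonempty rank-$0$ sets. $\mathcal{M}|V'$ is the restriction of $\mathcal{M}$ to $V'$; $\mathcal{N}/A$ is the contraction by $A$ (ground set minus $A$, independent sets $S$ with $S\cup B_A$ independent for a maximal independent $B_A\subseteq A$). Density-based decomposition of $V'$: for $j=1,\dots,k$, $U_j$ is the subset of largest cardinality among the subsets of $V'\setminus(U_1\cup\dots\cup U_{j-1})$ of maximum density in $\mathcal{M}'/(U_1\cup\dots\cup U_{j-1})$ (this set is unique; some $U_j$ may be empty). -}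

module Defs where

open import Data.Nat using (ℕ; zero; suc; _*_; _≤_; _<_; _⊔_)
open import Data.Bool using (Bool; true; false; T; _∧_; _∨_; not; if_then_else_)
open import Data.List using (List; []; _∷_; map; _++_)
open import Data.Vec using (_∷_; [])
open import Data.Fin using (Fin)
open import Data.Fin.Subset
  using (Subset; inside; outside; ⊥; ⁅_⁆; _∈_; _∉_; _⊆_; _∪_; _∩_; _─_; ∣_∣)
open import Data.Fin.Subset.Properties using (_⊆?_)
open import Data.Product using (Σ; ∃; _×_; _,_)
open import Relation.Nullary.Decidable using (⌊_⌋)
open import Relation.Binary.PropositionalEquality using (_≡_)
open import Data.Empty using () renaming (⊥ to False)

allSubsets : (n : ℕ) → List (Subset n)
allSubsets zero    = [] ∷ []
allSubsets (suc n) = map (outside ∷_) (allSubsets n) ++ map (inside ∷_) (allSubsets n)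

_⊆ᵇ_ : {n : ℕ} → Subset n → Subset n → Bool
A ⊆ᵇ B = ⌊ A ⊆? B ⌋

anyᵇ : {A : Set} → (A → Bool) → List A → Bool
anyᵇ p []       = false
anyᵇ p (x ∷ xs) = p x ∨ anyᵇ p xs

allᵇ : {A : Set} → (A → Bool) → List A → Bool
allᵇ p []       = true
allᵇ p (x ∷ xs) = p x ∧ allᵇ p xs

maxCardᵇ : {n : ℕ} → (Subset n → Bool) → List (Subset n) → ℕ
maxCardᵇ p []       = 0
maxCardᵇ p (I ∷ Is) = (if p I then ∣ I ∣ else 0) ⊔ maxCardᵇ p Is

-- A (finite) set system on a ground set E ⊆ Fin n, given by a Boolean
-- independence oracle.  Matroids, their restrictions and contractions are
-- all represented in this form.

record SetSystem (n : ℕ) : Set where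
  field
    ground : Subset n
    indep  : Subset n → Bool
open SetSystem public

Indep : {n : ℕ} → SetSystem n → Subset n → Set
Indep N I = T (indep N I)

record IsMatroid {n : ℕ} (M : SetSystem n) : Set where
  field
    indep⊆ground : ∀ I → Indep M I → I ⊆ ground M
    indep-∅      : Indep M ⊥
    hereditary   : ∀ I J → J ⊆ I → Indep M I → Indep M J
    exchange     : ∀ I J → Indep M I → Indep M J → ∣ I ∣ < ∣ J ∣ →
                   ∃ λ x → x ∈ J × x ∉ I × Indep M (I ∪ ⁅ x ⁆)

Loopless : {n : ℕ} → SetSystem n → Set
Loopless M = ∀ x → x ∈ ground M → Indep M ⁅ x ⁆

rank : {n : ℕ} → SetSystem n → Subset n → ℕ
rank {n} N U =
  maxCardᵇ (λ I → (I ⊆ᵇ U) ∧ indep N I) (allSubsets n)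

_∣ʳ_ : {n : ℕ} → SetSystem n → Subset n → SetSystem n
N ∣ʳ V' = record { ground = V' ; indep = λ I → (I ⊆ᵇ V') ∧ indep N I }

isMaxIndepᵇ : {n : ℕ} → SetSystem n → Subset n → Subset n → Bool
isMaxIndepᵇ {n} N A B =
  (B ⊆ᵇ A) ∧ indep N B ∧
  allᵇ (λ C → not ((B ⊆ᵇ C) ∧ (C ⊆ᵇ A) ∧ indep N C) ∨ (C ⊆ᵇ B)) (allSubsets n)

_/ᶜ_ : {n : ℕ} → SetSystem n → Subset n → SetSystem n
_/ᶜ_ {n} N A = record
  { ground = ground N ─ A
  ; indep  = λ S → (S ⊆ᵇ (ground N ─ A)) ∧
                   anyᵇ (λ B → isMaxIndepᵇ N A B ∧ indep N (S ∪ B)) (allSubsets n)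
  }

-- Extended non-negative rationals  (fin p q stands for p / q, q > 0) and ∞.

data ℚ∞ : Set where
  fin : ℕ → ℕ → ℚ∞
  ∞   : ℚ∞

_≤∞_ : ℚ∞ → ℚ∞ → Set
fin a b ≤∞ fin c d = a * d ≤ c * b
fin a b ≤∞ ∞       = Data.Unit.⊤ where import Data.Unit
∞       ≤∞ fin _ _ = False
∞       ≤∞ ∞       = Data.Unit.⊤ where import Data.Unit

_<∞_ : ℚ∞ → ℚ∞ → Set
fin a b <∞ fin c d = a * d < c * b
fin a b <∞ ∞       = Data.Unit.⊤ where import Data.Unit
∞       <∞ _       = False

_≈∞_ : ℚ∞ → ℚ∞ → Set
x ≈∞ y = (x ≤∞ y) × (y ≤∞ x)

ρ : {n : ℕ} → SetSystem n → Subset n → ℚ∞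
ρ N U with ∣ U ∣ | rank N U
... | zero  | _     = fin 0 1
... | suc m | zero  = ∞
... | suc m | suc r = fin (suc m) (suc r)

-- Pre U j = U 1 ∪ … ∪ U (j-1)   (indices start at 1).
Pre : {n : ℕ} → (ℕ → Subset n) → ℕ → Subset n
Pre U zero          = ⊥
Pre U (suc zero)    = ⊥
Pre U (suc (suc j)) = Pre U (suc j) ∪ U (suc j)

IsDecompStep : {n : ℕ} → SetSystem n → Subset n → (ℕ → Subset n) → ℕ → Set
IsDecompStep M' V' U j =
  let C = Pre U j ; N = M' /ᶜ C ; R = V' ─ C in
  (U j ⊆ R) ×
  (∀ W → W ⊆ R → ρ N W ≤∞ ρ N (U j)) ×
  (∀ W → W ⊆ R → ρ N W ≈∞ ρ N (U j) → ∣ W ∣ ≤ ∣ U j ∣)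

IsDensityDecomposition : {n : ℕ} → SetSystem n → Subset n → ℕ → (ℕ → Subset n) → Set
IsDensityDecomposition M' V' k U = ∀ j → 1 ≤ j → j ≤ k → IsDecompStep M' V' U j

-- Write C = U₁ ∪ … ∪ U_{j-1}, N = M'/C, N' = M'/(C ∪ U_j) and W = U_{j+1}.
-- For the contraction one has rank_N(U_j ∪ W) ≤ rank_N(U_j) + rank_N'(W):
-- an N-independent subset of U_j ∪ W splits, after exchanging against a
-- maximal independent subset of C ∪ U_j, into an N-independent part of U_j
-- and an N'-independent part of W.  If W were at least as dense in N' as U_j
-- is in N, the mediant inequality would make U_j ∪ W at least as dense in N
-- as U_j, contradicting that U_j is the largest set of maximum density.
-- So a nonempty W is strictly sparser, and an empty W has density 0.
module Submission where

open import Defs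
open import Data.Nat using (ℕ; zero; suc; _+_; _*_; _≤_; _<_; _∸_; z≤n; s≤s; z<s; _≤?_; _<?_)
open import Data.Nat.Properties
open import Data.Bool using (Bool; true; false; T; _∧_; _∨_; not)
open import Data.Bool.Properties using (T-∧; T-∨)
open import Data.List using ([]; _∷_; map)
open import Data.List.Membership.Propositional using () renaming (_∈_ to _∈ˡ_)
open import Data.List.Membership.Propositional.Properties using (∈-map⁺; ∈-++⁺ˡ; ∈-++⁺ʳ)
open import Data.List.Relation.Unary.Any using (here; there)
open import Data.Vec using (_∷_; []; here; there)
open import Data.Fin using (Fin)
open import Data.Fin.Subset
  using (Subset; inside; outside; _∈_; _∉_; _⊆_; _∪_; _∩_; _─_; ∣_∣; ⁅_⁆)
open import Data.Fin.Subset.Properties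
open import Data.Product using (∃; ∃₂; _×_; _,_; proj₁; proj₂)
open import Data.Sum using (_⊎_; inj₁; inj₂; [_,_]′)
open import Data.Empty using (⊥-elim)
open import Data.Unit using (tt)
open import Function using (_∘_)
open import Function.Bundles using (Equivalence)
open import Relation.Binary.PropositionalEquality
open import Relation.Nullary using (Dec; yes; no; contradiction)
open import Relation.Nullary.Decidable using (toWitness; fromWitness; _×-dec_; T?)

private
  variable
    n : ℕ
    p q r : Subset n

x∈p─q⇒x∉q : ∀ {x : Fin n} (p q : Subset n) → x ∈ p ─ q → x ∉ q
x∈p─q⇒x∉q (inside  ∷ p) (outside ∷ q) here ()
x∈p─q⇒x∉q (_       ∷ p) (_       ∷ q) (there x∈) (there x∈q) = x∈p─q⇒x∉q p q x∈ x∈q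

x∈p∪q∧x∉p⇒x∈q : ∀ {x : Fin n} → x ∈ p ∪ q → x ∉ p → x ∈ q
x∈p∪q∧x∉p⇒x∈q {p = p} {q = q} x∈p∪q x∉p with x∈p∪q⁻ p q x∈p∪q
... | inj₁ x∈p = contradiction x∈p x∉p
... | inj₂ x∈q = x∈q

x∈p∪q∧x∉q⇒x∈p : ∀ {x : Fin n} → x ∈ p ∪ q → x ∉ q → x ∈ p
x∈p∪q∧x∉q⇒x∈p {p = p} {q = q} x∈p∪q x∉q with x∈p∪q⁻ p q x∈p∪q
... | inj₁ x∈p = x∈p
... | inj₂ x∈q = contradiction x∈q x∉q

p─[q∪r]⊆p─q : ∀ (p q r : Subset n) → p ─ (q ∪ r) ⊆ p ─ q
p─[q∪r]⊆p─q p q r = p─q⊆p (p ─ q) r ∘ ⊆-reflexive (sym (p─q─r≡p─q∪r p q r))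

x∈p⇒⁅x⁆⊆p : ∀ {x : Fin n} → x ∈ p → ⁅ x ⁆ ⊆ p
x∈p⇒⁅x⁆⊆p {p = p} {x = x} x∈p y∈⁅x⁆ = subst (_∈ p) (sym (x∈⁅y⁆⇒x≡y x y∈⁅x⁆)) x∈p

∪-lub : p ⊆ r → q ⊆ r → p ∪ q ⊆ r
∪-lub {p = p} {q = q} p⊆r q⊆r x∈ = [ p⊆r , q⊆r ]′ (x∈p∪q⁻ p q x∈)

∣p∪q∣≡∣p∣+∣q∣ : ∀ (p q : Subset n) → (∀ {x} → x ∈ p → x ∉ q) → ∣ p ∪ q ∣ ≡ ∣ p ∣ + ∣ q ∣
∣p∪q∣≡∣p∣+∣q∣ []            []            _        = refl
∣p∪q∣≡∣p∣+∣q∣ (inside  ∷ p) (inside  ∷ q) disjoint = ⊥-elim (disjoint here here)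
∣p∪q∣≡∣p∣+∣q∣ (inside  ∷ p) (outside ∷ q) disjoint =
  cong suc (∣p∪q∣≡∣p∣+∣q∣ p q (λ x∈p x∈q → disjoint (there x∈p) (there x∈q)))
∣p∪q∣≡∣p∣+∣q∣ (outside ∷ p) (inside  ∷ q) disjoint =
  trans (cong suc (∣p∪q∣≡∣p∣+∣q∣ p q (λ x∈p x∈q → disjoint (there x∈p) (there x∈q))))
        (sym (+-suc ∣ p ∣ ∣ q ∣))
∣p∪q∣≡∣p∣+∣q∣ (outside ∷ p) (outside ∷ q) disjoint =
  ∣p∪q∣≡∣p∣+∣q∣ p q (λ x∈p x∈q → disjoint (there x∈p) (there x∈q))

∣q∣≡∣p∣+∣q─p∣ : p ⊆ q → ∣ q ∣ ≡ ∣ p ∣ + ∣ q ─ p ∣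
∣q∣≡∣p∣+∣q─p∣ {p = []}          {q = []}          _   = refl
∣q∣≡∣p∣+∣q─p∣ {p = inside  ∷ p} {q = inside  ∷ q} p⊆q = cong suc (∣q∣≡∣p∣+∣q─p∣ (drop-∷-⊆ p⊆q))
∣q∣≡∣p∣+∣q─p∣ {p = inside  ∷ p} {q = outside ∷ q} p⊆q with () ← p⊆q here
∣q∣≡∣p∣+∣q─p∣ {p = outside ∷ p} {q = inside  ∷ q} p⊆q =
  trans (cong suc (∣q∣≡∣p∣+∣q─p∣ (drop-∷-⊆ p⊆q))) (sym (+-suc ∣ p ∣ _))
∣q∣≡∣p∣+∣q─p∣ {p = outside ∷ p} {q = outside ∷ q} p⊆q = ∣q∣≡∣p∣+∣q─p∣ (drop-∷-⊆ p⊆q)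

p⊆q∧∣q∣≤∣p∣⇒q⊆p : p ⊆ q → ∣ q ∣ ≤ ∣ p ∣ → q ⊆ p
p⊆q∧∣q∣≤∣p∣⇒q⊆p {p = p} p⊆q ∣q∣≤∣p∣ {x} x∈q with x ∈? p
... | yes x∈p = x∈p
... | no  x∉p = contradiction (p⊂q⇒∣p∣<∣q∣ (p⊆q , x , x∈q , x∉p)) (≤⇒≯ ∣q∣≤∣p∣)

∣p∪⁅x⁆∣≡1+∣p∣ : ∀ {x : Fin n} (p : Subset n) → x ∉ p → ∣ p ∪ ⁅ x ⁆ ∣ ≡ suc ∣ p ∣
∣p∪⁅x⁆∣≡1+∣p∣ {x = x} p x∉p = begin
  ∣ p ∪ ⁅ x ⁆ ∣    ≡⟨ ∣p∪q∣≡∣p∣+∣q∣ p ⁅ x ⁆ (λ y∈p y∈⁅x⁆ → x∉p (subst (_∈ p) (x∈⁅y⁆⇒x≡y x y∈⁅x⁆) y∈p)) ⟩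
  ∣ p ∣ + ∣ ⁅ x ⁆ ∣ ≡⟨ cong (∣ p ∣ +_) (∣⁅x⁆∣≡1 x) ⟩
  ∣ p ∣ + 1         ≡⟨ +-comm ∣ p ∣ 1 ⟩
  suc ∣ p ∣         ∎
  where open ≡-Reasoning

∧⁻ : ∀ {a b} → T (a ∧ b) → T a × T b
∧⁻ = Equivalence.to T-∧

∧⁺ : ∀ {a b} → T a → T b → T (a ∧ b)
∧⁺ ta tb = Equivalence.from T-∧ (ta , tb)

⊆ᵇ⇒⊆ : ∀ {A B : Subset n} → T (A ⊆ᵇ B) → A ⊆ B
⊆ᵇ⇒⊆ {A = A} {B} = toWitness {a? = A ⊆? B}

⊆⇒⊆ᵇ : ∀ {A B : Subset n} → A ⊆ B → T (A ⊆ᵇ B)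
⊆⇒⊆ᵇ {A = A} {B} = fromWitness {a? = A ⊆? B}

∈-allSubsets : ∀ n (A : Subset n) → A ∈ˡ allSubsets n
∈-allSubsets zero    []            = here refl
∈-allSubsets (suc n) (outside ∷ A) = ∈-++⁺ˡ (∈-map⁺ (outside ∷_) (∈-allSubsets n A))
∈-allSubsets (suc n) (inside  ∷ A) =
  ∈-++⁺ʳ (map (outside ∷_) (allSubsets n)) (∈-map⁺ (inside ∷_) (∈-allSubsets n A))

anyᵇ⁻ : ∀ {A : Set} (f : A → Bool) xs → T (anyᵇ f xs) → ∃ λ x → T (f x)
anyᵇ⁻ f (x ∷ xs) t with f x in fx
... | true  = x , subst T (sym fx) tt
... | false = anyᵇ⁻ f xs t

anyᵇ⁺ : ∀ {A : Set} (f : A → Bool) {xs x} → x ∈ˡ xs → T (f x) → T (anyᵇ f xs)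
anyᵇ⁺ f (here refl) t = Equivalence.from T-∨ (inj₁ t)
anyᵇ⁺ f (there x∈)  t = Equivalence.from T-∨ (inj₂ (anyᵇ⁺ f x∈ t))

allᵇ⁻ : ∀ {A : Set} (f : A → Bool) {xs x} → x ∈ˡ xs → T (allᵇ f xs) → T (f x)
allᵇ⁻ f (here refl)          t = proj₁ (∧⁻ t)
allᵇ⁻ f {xs = y ∷ _} (there x∈) t = allᵇ⁻ f x∈ (proj₂ (∧⁻ {f y} t))

allᵇ⁺ : ∀ {A : Set} (f : A → Bool) xs → (∀ x → T (f x)) → T (allᵇ f xs)
allᵇ⁺ f []       all = tt
allᵇ⁺ f (x ∷ xs) all = ∧⁺ (all x) (allᵇ⁺ f xs all)

maxCard-ub : ∀ (f : Subset n → Bool) {Is I} → I ∈ˡ Is → T (f I) → ∣ I ∣ ≤ maxCardᵇ f Is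
maxCard-ub f {I = I} (here refl) t with f I
... | true = m≤m⊔n _ _
maxCard-ub f (there I∈) t = ≤-trans (maxCard-ub f I∈ t) (m≤n⊔m _ _)

maxCard-lub : ∀ (f : Subset n → Bool) Is {m} → (∀ I → T (f I) → ∣ I ∣ ≤ m) → maxCardᵇ f Is ≤ m
maxCard-lub f []       bound = z≤n
maxCard-lub f (J ∷ Is) bound with f J in fJ
... | true  = ⊔-lub (bound J (subst T (sym fJ) tt)) (maxCard-lub f Is bound)
... | false = ⊔-lub z≤n (maxCard-lub f Is bound)

∃-maxCard : {P : Subset n → Set} → (∀ A → Dec (P A)) → ∀ {A} → P A →
            ∃ λ Z → P Z × (∀ B → P B → ∣ B ∣ ≤ ∣ Z ∣)
∃-maxCard {n} {P} P? {A} PA with maxOf (allSubsets n)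
  where
  maxOf : ∀ Bs → ∃ λ Z → P Z × (∀ {B} → B ∈ˡ Bs → P B → ∣ B ∣ ≤ ∣ Z ∣)
  maxOf []       = A , PA , λ ()
  maxOf (B ∷ Bs) with maxOf Bs | P? B
  ... | Z , PZ , Z-max | no ¬PB = Z , PZ , λ { (here refl) PB → contradiction PB ¬PB ; (there B∈) → Z-max B∈ }
  ... | Z , PZ , Z-max | yes PB with ∣ B ∣ ≤? ∣ Z ∣
  ...   | yes B≤Z = Z , PZ , λ { (here refl) _ → B≤Z ; (there C∈) → Z-max C∈ }
  ...   | no  B≰Z = B , PB , λ { (here refl) _ → ≤-refl
                               ; (there C∈) PC → ≤-trans (Z-max C∈ PC) (<⇒≤ (≰⇒> B≰Z)) }
... | Z , PZ , Z-max = Z , PZ , λ B → Z-max (∈-allSubsets n B)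

∣I∣≤rank : ∀ (N : SetSystem n) {U I} → I ⊆ U → Indep N I → ∣ I ∣ ≤ rank N U
∣I∣≤rank {n} N {I = I} I⊆U I-indep =
  maxCard-ub _ (∈-allSubsets n I) (∧⁺ (⊆⇒⊆ᵇ I⊆U) I-indep)

rank-lub : ∀ (N : SetSystem n) U {m} → (∀ I → I ⊆ U → Indep N I → ∣ I ∣ ≤ m) → rank N U ≤ m
rank-lub {n} N U bound = maxCard-lub _ (allSubsets n) λ I t →
  let I⊆U , I-indep = ∧⁻ {I ⊆ᵇ U} t in bound I (⊆ᵇ⇒⊆ I⊆U) I-indep

record MaxIndep (N : SetSystem n) (A B : Subset n) : Set where
  field
    isSubset  : B ⊆ A
    isIndep   : Indep N B
    isMaximal : ∀ C → B ⊆ C → C ⊆ A → Indep N C → C ⊆ B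

isMaxIndepᵇ⇒MaxIndep : ∀ (N : SetSystem n) {A B} → T (isMaxIndepᵇ N A B) → MaxIndep N A B
isMaxIndepᵇ⇒MaxIndep {n} N {A} {B} t = record
  { isSubset  = ⊆ᵇ⇒⊆ B⊆A
  ; isIndep   = B-indep
  ; isMaximal = λ C B⊆C C⊆A C-indep →
      ⊆ᵇ⇒⊆ (implies (⊆⇒⊆ᵇ B⊆C) (⊆⇒⊆ᵇ C⊆A) C-indep (allᵇ⁻ _ (∈-allSubsets n C) B-maximal))
  }
  where
  B-maximalᵇ : Bool
  B-maximalᵇ = allᵇ (λ C → not ((B ⊆ᵇ C) ∧ (C ⊆ᵇ A) ∧ indep N C) ∨ (C ⊆ᵇ B)) (allSubsets n)
  B⊆A : T (B ⊆ᵇ A)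
  B⊆A = proj₁ (∧⁻ t)
  B-indep : Indep N B
  B-indep = proj₁ (∧⁻ {indep N B} {B-maximalᵇ} (proj₂ (∧⁻ {B ⊆ᵇ A} t)))
  B-maximal : T B-maximalᵇ
  B-maximal = proj₂ (∧⁻ {indep N B} (proj₂ (∧⁻ {B ⊆ᵇ A} t)))
  implies : ∀ {a b c d} → T a → T b → T c → T (not (a ∧ b ∧ c) ∨ d) → T d
  implies {true} {true} {true} _ _ _ td = td

MaxIndep⇒isMaxIndepᵇ : ∀ (N : SetSystem n) {A B} → MaxIndep N A B → T (isMaxIndepᵇ N A B)
MaxIndep⇒isMaxIndepᵇ {n} N {A} {B} B-max =
  ∧⁺ (⊆⇒⊆ᵇ isSubset) (∧⁺ isIndep (allᵇ⁺ _ (allSubsets n) maximal))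
  where
  open MaxIndep B-max
  maximal : ∀ C → T (not ((B ⊆ᵇ C) ∧ (C ⊆ᵇ A) ∧ indep N C) ∨ (C ⊆ᵇ B))
  maximal C with B ⊆ᵇ C in B⊆C | C ⊆ᵇ A in C⊆A | indep N C in C-indep
  ... | false | _     | _     = tt
  ... | true  | false | _     = tt
  ... | true  | true  | false = tt
  ... | true  | true  | true  = Equivalence.from T-∨ (inj₂ (⊆⇒⊆ᵇ (isMaximal C
          (⊆ᵇ⇒⊆ (subst T (sym B⊆C) tt)) (⊆ᵇ⇒⊆ (subst T (sym C⊆A) tt)) (subst T (sym C-indep) tt))))

indep-/ᶜ⁻ : ∀ (N : SetSystem n) A {S} → Indep (N /ᶜ A) S →
            S ⊆ ground N ─ A × ∃ λ B → MaxIndep N A B × Indep N (S ∪ B)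
indep-/ᶜ⁻ {n} N A t with ∧⁻ t
... | S⊆ , witness with anyᵇ⁻ _ (allSubsets n) witness
... | B , u = ⊆ᵇ⇒⊆ S⊆ , B , isMaxIndepᵇ⇒MaxIndep N (proj₁ (∧⁻ u)) , proj₂ (∧⁻ {isMaxIndepᵇ N A B} u)

indep-/ᶜ⁺ : ∀ (N : SetSystem n) A {S B} → S ⊆ ground N ─ A → MaxIndep N A B → Indep N (S ∪ B) →
            Indep (N /ᶜ A) S
indep-/ᶜ⁺ {n} N A {B = B} S⊆ B-max S∪B-indep =
  ∧⁺ (⊆⇒⊆ᵇ S⊆) (anyᵇ⁺ _ (∈-allSubsets n B) (∧⁺ (MaxIndep⇒isMaxIndepᵇ N B-max) S∪B-indep))

extend-to-MaxIndep : ∀ (N : SetSystem n) {Y A} → Indep N Y → Y ⊆ A → ∃ λ B → Y ⊆ B × MaxIndep N A B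
extend-to-MaxIndep N {Y} {A} Y-indep Y⊆A
  with ∃-maxCard (λ Z → Y ⊆? Z ×-dec (Z ⊆? A ×-dec T? (indep N Z))) (⊆-refl , Y⊆A , Y-indep)
... | B , (Y⊆B , B⊆A , B-indep) , B-max = B , Y⊆B , record
  { isSubset  = B⊆A
  ; isIndep   = B-indep
  ; isMaximal = λ C B⊆C C⊆A C-indep →
      p⊆q∧∣q∣≤∣p∣⇒q⊆p B⊆C (B-max C (⊆-trans Y⊆B B⊆C , C⊆A , C-indep))
  }

∣ʳ-isMatroid : ∀ {M : SetSystem n} → IsMatroid M → (V' : Subset n) → IsMatroid (M ∣ʳ V')
∣ʳ-isMatroid M-matroid V' = record
  { indep⊆ground = λ I t → ⊆ᵇ⇒⊆ (proj₁ (∧⁻ t))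
  ; indep-∅      = ∧⁺ (⊆⇒⊆ᵇ ⊥⊆) indep-∅
  ; hereditary   = λ I J J⊆I t →
      let I⊆V' , I-indep = ∧⁻ t in ∧⁺ (⊆⇒⊆ᵇ (⊆ᵇ⇒⊆ I⊆V' ∘ J⊆I)) (hereditary I J J⊆I I-indep)
  ; exchange     = λ I J tI tJ ∣I∣<∣J∣ →
      let I⊆V' , I-indep = ∧⁻ tI ; J⊆V' , J-indep = ∧⁻ tJ
          x , x∈J , x∉I , I∪x-indep = exchange I J I-indep J-indep ∣I∣<∣J∣
      in x , x∈J , x∉I ,
         ∧⁺ (⊆⇒⊆ᵇ (∪-lub (⊆ᵇ⇒⊆ I⊆V') (x∈p⇒⁅x⁆⊆p (⊆ᵇ⇒⊆ J⊆V' x∈J)))) I∪x-indep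
  }
  where open IsMatroid M-matroid

module _ {M : SetSystem n} (M-matroid : IsMatroid M) where
  open IsMatroid M-matroid

  augment : ∀ {P Q} → Indep M P → Indep M Q →
            ∃ λ Z → P ⊆ Z × Z ⊆ P ∪ Q × Indep M Z × ∣ Q ∣ ≤ ∣ Z ∣
  augment {P} {Q} P-indep Q-indep
    with ∃-maxCard (λ Z → P ⊆? Z ×-dec (Z ⊆? P ∪ Q ×-dec T? (indep M Z))) (⊆-refl , p⊆p∪q Q , P-indep)
  ... | Z , (P⊆Z , Z⊆P∪Q , Z-indep) , Z-max with ∣ Z ∣ <? ∣ Q ∣
  ... | no ∣Z∣≮∣Q∣ = Z , P⊆Z , Z⊆P∪Q , Z-indep , ≮⇒≥ ∣Z∣≮∣Q∣
  ... | yes ∣Z∣<∣Q∣ with exchange Z Q Z-indep Q-indep ∣Z∣<∣Q∣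
  ... | x , x∈Q , x∉Z , Z∪x-indep = ⊥-elim (n≮n ∣ Z ∣ (subst (_≤ ∣ Z ∣) (∣p∪⁅x⁆∣≡1+∣p∣ Z x∉Z) Z∪x-fits))
    where
    Z∪x-fits : ∣ Z ∪ ⁅ x ⁆ ∣ ≤ ∣ Z ∣
    Z∪x-fits = Z-max (Z ∪ ⁅ x ⁆)
      ( ⊆-trans P⊆Z (p⊆p∪q ⁅ x ⁆)
      , ∪-lub Z⊆P∪Q (x∈p⇒⁅x⁆⊆p (q⊆p∪q P Q x∈Q))
      , Z∪x-indep )

  indep-/ᶜ-split : ∀ C {U W I} → U ⊆ ground M ─ C → W ⊆ ground M ─ (C ∪ U) →
                   I ⊆ U ∪ W → Indep (M /ᶜ C) I →
                   ∃₂ λ K L → K ⊆ U × Indep (M /ᶜ C) K × L ⊆ W × Indep (M /ᶜ (C ∪ U)) L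
                            × ∣ I ∣ ≤ ∣ K ∣ + ∣ L ∣
  indep-/ᶜ-split C {U} {W} {I} U⊆ W⊆ I⊆U∪W I-indep
    with indep-/ᶜ⁻ M C I-indep
  ... | I⊆ , B , B-max , I∪B-indep
    with extend-to-MaxIndep M
           (hereditary (I ∪ B) ((I ∩ U) ∪ B) (∪-lub (p⊆p∪q B ∘ p∩q⊆p I U) (q⊆p∪q I B)) I∪B-indep)
           (∪-lub (q⊆p∪q C U ∘ p∩q⊆q I U) (p⊆p∪q U ∘ MaxIndep.isSubset B-max))
  ... | B' , I∩U∪B⊆B' , B'-max
    with augment (MaxIndep.isIndep B'-max) I∪B-indep
  ... | Z , B'⊆Z , Z⊆B'∪I∪B , Z-indep , ∣I∪B∣≤∣Z∣ =
    B' ─ B , Z ─ B' ,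
    B'─B⊆U , indep-/ᶜ⁺ M C (U⊆ ∘ B'─B⊆U) B-max
               (hereditary B' _ (∪-lub (p─q⊆p B' B) B⊆B') (MaxIndep.isIndep B'-max)) ,
    Z─B'⊆W , indep-/ᶜ⁺ M (C ∪ U) (W⊆ ∘ Z─B'⊆W) B'-max
               (hereditary Z _ (∪-lub (p─q⊆p Z B') B'⊆Z) Z-indep) ,
    ∣I∣≤∣B'─B∣+∣Z─B'∣
    where
    B⊆B' : B ⊆ B'
    B⊆B' = I∩U∪B⊆B' ∘ q⊆p∪q (I ∩ U) B

    B'∩C⊆B : B' ∩ C ⊆ B
    B'∩C⊆B = MaxIndep.isMaximal B-max (B' ∩ C)
      (λ x∈B → x∈p∩q⁺ (B⊆B' x∈B , MaxIndep.isSubset B-max x∈B))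
      (p∩q⊆q B' C) (hereditary B' (B' ∩ C) (p∩q⊆p B' C) (MaxIndep.isIndep B'-max))

    B'─B⊆U : B' ─ B ⊆ U
    B'─B⊆U x∈ =
      let x∈B' = p─q⊆p B' B x∈
      in x∈p∪q∧x∉p⇒x∈q (MaxIndep.isSubset B'-max x∈B')
                        (x∈p─q⇒x∉q B' B x∈ ∘ B'∩C⊆B ∘ x∈p∩q⁺ ∘ (x∈B' ,_))

    Z─B'⊆W : Z ─ B' ⊆ W
    Z─B'⊆W x∈ =
      let x∉B' = x∈p─q⇒x∉q Z B' x∈
          x∈I  = x∈p∪q∧x∉q⇒x∈p (x∈p∪q∧x∉p⇒x∈q (Z⊆B'∪I∪B (p─q⊆p Z B' x∈)) x∉B') (x∉B' ∘ B⊆B')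
      in x∈p∪q∧x∉p⇒x∈q (I⊆U∪W x∈I) (x∉B' ∘ I∩U∪B⊆B' ∘ p⊆p∪q B ∘ x∈p∩q⁺ ∘ (x∈I ,_))

    ∣I∣≤∣B'─B∣+∣Z─B'∣ : ∣ I ∣ ≤ ∣ B' ─ B ∣ + ∣ Z ─ B' ∣
    ∣I∣≤∣B'─B∣+∣Z─B'∣ = +-cancelʳ-≤ ∣ B ∣ ∣ I ∣ _ (begin
      ∣ I ∣ + ∣ B ∣                   ≡⟨ ∣p∪q∣≡∣p∣+∣q∣ I B I-disjoint-B ⟨
      ∣ I ∪ B ∣                       ≤⟨ ∣I∪B∣≤∣Z∣ ⟩
      ∣ Z ∣                           ≡⟨ ∣q∣≡∣p∣+∣q─p∣ B'⊆Z ⟩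
      ∣ B' ∣ + ∣ Z ─ B' ∣             ≡⟨ cong (_+ ∣ Z ─ B' ∣) (∣q∣≡∣p∣+∣q─p∣ B⊆B') ⟩
      ∣ B ∣ + ∣ B' ─ B ∣ + ∣ Z ─ B' ∣ ≡⟨ trans (+-assoc ∣ B ∣ _ _) (+-comm ∣ B ∣ _) ⟩
      ∣ B' ─ B ∣ + ∣ Z ─ B' ∣ + ∣ B ∣ ∎)
      where
      open ≤-Reasoning
      I-disjoint-B : ∀ {x} → x ∈ I → x ∉ B
      I-disjoint-B x∈I = x∈p─q⇒x∉q (ground M) C (I⊆ x∈I) ∘ MaxIndep.isSubset B-max

  rank-/ᶜ-∪ : ∀ C {U W} → U ⊆ ground M ─ C → W ⊆ ground M ─ (C ∪ U) →
              rank (M /ᶜ C) (U ∪ W) ≤ rank (M /ᶜ C) U + rank (M /ᶜ (C ∪ U)) W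
  rank-/ᶜ-∪ C U⊆ W⊆ = rank-lub (M /ᶜ C) _ λ I I⊆U∪W I-indep →
    let K , L , K⊆U , K-indep , L⊆W , L-indep , ∣I∣≤∣K∣+∣L∣ = indep-/ᶜ-split C U⊆ W⊆ I⊆U∪W I-indep
    in ≤-trans ∣I∣≤∣K∣+∣L∣ (+-mono-≤ (∣I∣≤rank (M /ᶜ C) K⊆U K-indep) (∣I∣≤rank (M /ᶜ _) L⊆W L-indep))

density : ℕ → ℕ → ℚ∞
density zero    _       = fin 0 1
density (suc m) zero    = ∞
density (suc m) (suc r) = fin (suc m) (suc r)

ρ≡density : ∀ (N : SetSystem n) U → ρ N U ≡ density ∣ U ∣ (rank N U)
ρ≡density N U with ∣ U ∣ | rank N U
... | zero  | _     = refl
... | suc m | zero  = refl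
... | suc m | suc r = refl

0≤∞ : ∀ x → fin 0 1 ≤∞ x
0≤∞ (fin _ _) = z≤n
0≤∞ ∞         = tt

<∞⇒≤∞ : ∀ x y → x <∞ y → x ≤∞ y
<∞⇒≤∞ (fin _ _) (fin _ _) x<y = <⇒≤ x<y
<∞⇒≤∞ (fin _ _) ∞         _   = tt

<∞⊎≥∞ : ∀ x y → x <∞ y ⊎ y ≤∞ x
<∞⊎≥∞ (fin a b) (fin c d) with a * d <? c * b
... | yes ad<cb = inj₁ ad<cb
... | no  ad≮cb = inj₂ (≮⇒≥ ad≮cb)
<∞⊎≥∞ (fin _ _) ∞         = inj₁ tt
<∞⊎≥∞ ∞         (fin _ _) = inj₂ tt
<∞⊎≥∞ ∞         ∞         = inj₂ tt

-- a/r ≤ b/s makes a/r ≤ (a + b)/(r + s) ≤ (a + b)/t, written cross-multiplied.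
*-mediant-≤ : ∀ a b r s t → t ≤ r + s → a * s ≤ b * r → a * t ≤ (a + b) * r
*-mediant-≤ a b r s t t≤r+s as≤br = begin
  a * t         ≤⟨ *-monoʳ-≤ a t≤r+s ⟩
  a * (r + s)   ≡⟨ *-distribˡ-+ a r s ⟩
  a * r + a * s ≤⟨ +-monoʳ-≤ (a * r) as≤br ⟩
  a * r + b * r ≡⟨ *-distribʳ-+ r a b ⟨
  (a + b) * r   ∎
  where open ≤-Reasoning

density-≤-mediant : ∀ a r b s t → t ≤ r + s → density a r ≤∞ density (suc b) s →
                    density a r ≤∞ density (a + suc b) t
density-≤-mediant zero    r       b s       t       _      _   = 0≤∞ _
density-≤-mediant (suc a) zero    b zero    zero    _      _   = tt
density-≤-mediant (suc a) zero    b (suc s) t       _      ()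
density-≤-mediant (suc a) (suc r) b s       zero    _      _   = tt
density-≤-mediant (suc a) (suc r) b zero    (suc t) t≤r+s  _   =
  *-mediant-≤ (suc a) (suc b) (suc r) 0 (suc t) t≤r+s (subst (_≤ suc b * suc r) (sym (*-zeroʳ (suc a))) z≤n)
density-≤-mediant (suc a) (suc r) b (suc s) (suc t) t≤r+s ar≤bs =
  *-mediant-≤ (suc a) (suc b) (suc r) (suc s) (suc t) t≤r+s ar≤bs

density-drops : ∀ a r b s t → t ≤ r + s →
                density (a + b) t ≤∞ density a r →
                (density (a + b) t ≈∞ density a r → a + b ≤ a) →
                density b s ≤∞ density a r × (fin 0 1 <∞ density a r → density b s <∞ density a r)
density-drops a r zero    s t _     _        _         = 0≤∞ _ , λ 0<ρ → 0<ρ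
density-drops a r (suc b) s t t≤r+s ρ∪≤ρ largest with <∞⊎≥∞ (density (suc b) s) (density a r)
... | inj₁ ρ'<ρ = <∞⇒≤∞ _ _ ρ'<ρ , λ _ → ρ'<ρ
... | inj₂ ρ≤ρ' = contradiction (largest (ρ∪≤ρ , density-≤-mediant a r b s t t≤r+s ρ≤ρ')) (<⇒≱ (m<m+n a z<s))

ρ-drops : ∀ (N N' : SetSystem n) (A B : Subset n) → (∀ {x} → x ∈ A → x ∉ B) →
          rank N (A ∪ B) ≤ rank N A + rank N' B →
          ρ N (A ∪ B) ≤∞ ρ N A → (ρ N (A ∪ B) ≈∞ ρ N A → ∣ A ∪ B ∣ ≤ ∣ A ∣) →
          ρ N' B ≤∞ ρ N A × (fin 0 1 <∞ ρ N A → ρ N' B <∞ ρ N A)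
ρ-drops N N' A B A-disjoint-B rank≤
  rewrite ρ≡density N A | ρ≡density N' B | ρ≡density N (A ∪ B) | ∣p∪q∣≡∣p∣+∣q∣ A B A-disjoint-B
  = density-drops (∣ A ∣) (rank N A) (∣ B ∣) (rank N' B) (rank N (A ∪ B)) rank≤

≤∸1⇒< : ∀ {m n} → 1 ≤ m → m ≤ n ∸ 1 → m < n
≤∸1⇒< {n = suc n} _       m≤n = s≤s m≤n
≤∸1⇒< {n = zero}  (s≤s _) ()

proposition17 : {n : ℕ} (M : SetSystem n) → IsMatroid M → Loopless M →
                (k : ℕ) → rank M (ground M) ≡ k →
                (V' : Subset n) → V' ⊆ ground M →
                (U : ℕ → Subset n) → IsDensityDecomposition (M ∣ʳ V') V' k U →
                ∀ j → 1 ≤ j → j ≤ k ∸ 1 →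
                (ρ ((M ∣ʳ V') /ᶜ Pre U (suc j)) (U (suc j)) ≤∞ ρ ((M ∣ʳ V') /ᶜ Pre U j) (U j))
                × (fin 0 1 <∞ ρ ((M ∣ʳ V') /ᶜ Pre U j) (U j) →
                   ρ ((M ∣ʳ V') /ᶜ Pre U (suc j)) (U (suc j)) <∞ ρ ((M ∣ʳ V') /ᶜ Pre U j) (U j))
proposition17 M M-matroid _ k _ V' _ U decomposition j@(suc _) 1≤j j≤k∸1 =
  ρ-drops N N' (U j) W Uj-disjoint-W
    (rank-/ᶜ-∪ (∣ʳ-isMatroid M-matroid V') C Uj⊆ W⊆)
    (Uj-densest (U j ∪ W) Uj∪W⊆) (Uj-largest (U j ∪ W) Uj∪W⊆)
  where
  C W : Subset _
  C = Pre U j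
  W = U (suc j)
  N N' : SetSystem _
  N = (M ∣ʳ V') /ᶜ C
  N' = (M ∣ʳ V') /ᶜ (C ∪ U j)
  j<k : j < k
  j<k = ≤∸1⇒< 1≤j j≤k∸1
  step-j : IsDecompStep (M ∣ʳ V') V' U j
  step-j = decomposition j 1≤j (<⇒≤ j<k)
  Uj⊆ : U j ⊆ V' ─ C
  Uj⊆ = proj₁ step-j
  Uj-densest : ∀ X → X ⊆ V' ─ C → ρ N X ≤∞ ρ N (U j)
  Uj-densest = proj₁ (proj₂ step-j)
  Uj-largest : ∀ X → X ⊆ V' ─ C → ρ N X ≈∞ ρ N (U j) → ∣ X ∣ ≤ ∣ U j ∣
  Uj-largest = proj₂ (proj₂ step-j)
  W⊆ : W ⊆ V' ─ (C ∪ U j)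
  W⊆ = proj₁ (decomposition (suc j) (s≤s z≤n) j<k)
  Uj∪W⊆ : U j ∪ W ⊆ V' ─ C
  Uj∪W⊆ = ∪-lub Uj⊆ (p─[q∪r]⊆p─q V' C (U j) ∘ W⊆)
  Uj-disjoint-W : ∀ {x} → x ∈ U j → x ∉ W
  Uj-disjoint-W x∈Uj x∈W = x∈p─q⇒x∉q V' (C ∪ U j) (W⊆ x∈W) (q⊆p∪q C (U j) x∈Uj)
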